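{- Let an instance of $3$-SAT$^*$ be given with $m$ 1-in-3-clauses $C_1,\dots,C_m$, $m$ 2-in-3-clauses $C_{m+1},\dots,C_{2m}$ and variables $x_1,\dots,x_n$. Construct the following restricted assignment instance with target makespan $T=322$. For each clause $C_i$ there are three clause machines $\mathtt{CMach}_{i,s}$, $s\in[3]$, each with a private load of $111$, and three clause jobs $\mathtt{CJob}^{\circ_{s'}}_{i,s'}$, $s'\in[3]$, where $\circ_1=\top$, $\circ_3=\bot$, and $\circ_2=\bot$ if $C_i$ is a 1-in-3-clause and $\circ_2=\top$ otherwise; a clause job with $\top$ has size $100$, with $\bot$ size $101$, and both are eligible exactly on $\mathtt{CMach}_{i,1},\mathtt{CMach}_{i,2},\mathtt{CMach}_{i,3}$. For each variable $x_j$ there are two truth assignment machines $\mathtt{TMach}_{j,1},\mathtt{TMach}_{j,2}$, two truth assignment jobs $\mathtt{TJob}_j^\top$ (size $100$) and $\mathtt{TJob}_j^\bot$ (size $102$), both eligible exactly on $\mathtt{TMach}_{j,1},\mathtt{TMach}_{j,2}$, and eight variable jobs $\mathtt{VJob}^\circ_{j,t}$, $t\in[4]$, $\circ\in\{\top,\bot\}$, of size $111$ if $\circ=\top$ and $110$ if $\circ=\bot$, eligible exactly on $\mathtt{TMach}_{j,\lceil t/2\rceil}$ and $\mathtt{CMach}_{\kappa(j,t)}$. Then the $3$-SAT$^*$ instance has a satisfying truth assignment if and only if the constructed instance has a schedule with makespan $T=322$.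
   Context: A 1-in-3-clause (resp. 2-in-3-clause) on literals $z_1,z_2,z_3$ is satisfied iff exactly one (resp. exactly two) of its literals is true. An instance of $3$-SAT$^*$ is a conjunction of clauses with exactly $3$ literals each, each clause being a 1-in-3-clause or a 2-in-3-clause, with as many clauses of each type, and such that each literal occurs exactly twice; the question is whether a satisfying truth assignment exists. Fix an ordering of the literal positions within each clause and index the occurrences of each variable $x_j$ by $t\in[4]$, where $t=1,2$ are the two positive and $t=3,4$ the two negative occurrences; $\kappa:[n]\times[4]\to[2m]\times[3]$ is the bijection with $\kappa(j,t)=(i,s)$ iff the $t$-th occurrence of $x_j$ is at position $s$ of clause $C_i$. Restricted assignment: machines and jobs with processing times and sets of eligible machines; a schedule assigns each job to an eligible machine; its makespan is the maximum total load on a machine. A private load of size $p$ on a machine is a job of size $p$ eligible only on that machine. -}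

module Defs where

open import Data.Nat using (ℕ; _≤_; _<_; _<ᵇ_)
open import Data.Bool using (Bool; true; false; if_then_else_; not)
open import Data.Fin using (Fin; toℕ; zero; suc)
open import Data.Fin.Properties using (_≟_)
open import Data.List using (List; []; _∷_; _++_; map; concatMap; allFin)
open import Data.Nat.ListAction using (sum)
open import Data.Product using (Σ; ∃; _×_; _,_; proj₁; proj₂)
open import Data.Sum using (_⊎_)
open import Function.Bundles using (_↔_; Inverse)
open import Relation.Binary.PropositionalEquality using (_≡_; refl; cong; cong₂)
open import Relation.Binary.Definitions using (DecidableEquality)
open import Relation.Nullary using (yes; no; ¬_)
open import Relation.Nullary.Decidable using (⌊_⌋)

record RAInstance : Set₁ where
  field
    Job      : Set
    Mach     : Set
    jobs     : List Job                 -- enumeration of all jobs (each once)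
    size     : Job → ℕ
    Eligible : Job → Mach → Set
    _≟M_     : DecidableEquality Mach

module _ (I : RAInstance) where
  open RAInstance I

  load : (Job → Mach) → Mach → ℕ
  load σ M = sum (map (λ j → if ⌊ σ j ≟M M ⌋ then size j else 0) jobs)

  HasScheduleWithin : ℕ → Set
  HasScheduleWithin T =
    Σ (Job → Mach) λ σ → (∀ j → Eligible j (σ j)) × (∀ M → load σ M ≤ T)

-- 3-SAT* instances (0-indexed)
-- m 1-in-3 clauses (indices i with toℕ i < m), m 2-in-3 clauses (the rest),
-- n variables; κ : (j , t) ↦ (i , s) the occurrence bijection, where
-- t ∈ {0,1} are the positive and t ∈ {2,3} the negative occurrences of x_j.

Occ : ℕ → Set
Occ n = Fin n × Fin 4

Pos : ℕ → Set
Pos m = Fin (m Data.Nat.+ m) × Fin 3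

isPositive : Fin 4 → Bool
isPositive t = toℕ t <ᵇ 2

isOneInThree : ∀ m → Fin (m Data.Nat.+ m) → Bool
isOneInThree m i = toℕ i <ᵇ m

litValue : ∀ {n} → (Fin n → Bool) → Occ n → Bool
litValue a (j , t) = if isPositive t then a j else not (a j)

boolToℕ : Bool → ℕ
boolToℕ true = 1
boolToℕ false = 0

trueCount : ∀ m {n} → Occ n ↔ Pos m → (Fin n → Bool) → Fin (m Data.Nat.+ m) → ℕ
trueCount m κ a i =
  sum (map (λ s → boolToℕ (litValue a (Inverse.from κ (i , s)))) (allFin 3))

Satisfies : ∀ m {n} → Occ n ↔ Pos m → (Fin n → Bool) → Set
Satisfies m κ a = ∀ i → trueCount m κ a i ≡ (if isOneInThree m i then 1 else 2)

Satisfiable : ∀ m {n} → Occ n ↔ Pos m → Set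
Satisfiable m {n} κ = Σ (Fin n → Bool) λ a → Satisfies m κ a

-- ⌈t/2⌉ in 0-indexed form
half : Fin 4 → Fin 2
half zero = zero
half (suc zero) = zero
half (suc (suc zero)) = suc zero
half (suc (suc (suc zero))) = suc zero

data RMach (m n : ℕ) : Set where
  cmach : Fin (m Data.Nat.+ m) → Fin 3 → RMach m n
  tmach : Fin n → Fin 2 → RMach m n

data RJob (m n : ℕ) : Set where
  priv : Fin (m Data.Nat.+ m) → Fin 3 → RJob m n          -- private load on CMach_{i,s}
  cjob : Fin (m Data.Nat.+ m) → Fin 3 → RJob m n
  tjob : Fin n → Bool → RJob m n
  vjob : Fin n → Fin 4 → Bool → RJob m n

_≟R_ : ∀ {m n} → DecidableEquality (RMach m n)
cmach i s ≟R cmach i' s' with i ≟ i' | s ≟ s'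
... | yes refl | yes refl = yes refl
... | no ne | _ = no λ { refl → ne refl }
... | yes _ | no ne = no λ { refl → ne refl }
cmach _ _ ≟R tmach _ _ = no λ ()
tmach _ _ ≟R cmach _ _ = no λ ()
tmach j k ≟R tmach j' k' with j ≟ j' | k ≟ k'
... | yes refl | yes refl = yes refl
... | no ne | _ = no λ { refl → ne refl }
... | yes _ | no ne = no λ { refl → ne refl }

-- ∘_{s'} for clause i: true = ⊤, false = ⊥
clauseSign : ∀ m → Fin (m Data.Nat.+ m) → Fin 3 → Bool
clauseSign m i zero = true
clauseSign m i (suc zero) = not (isOneInThree m i)
clauseSign m i (suc (suc zero)) = false

rsize : ∀ {m n} → RJob m n → ℕ
rsize (priv _ _) = 111
rsize {m} (cjob i s) = if clauseSign m i s then 100 else 101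
rsize (tjob _ b) = if b then 100 else 102
rsize (vjob _ _ b) = if b then 111 else 110

REligible : ∀ m {n} → Occ n ↔ Pos m → RJob m n → RMach m n → Set
REligible m κ (priv i s) M = M ≡ cmach i s
REligible m κ (cjob i _) M = ∃ λ s → M ≡ cmach i s
REligible m κ (tjob j _) M = ∃ λ k → M ≡ tmach j k
REligible m κ (vjob j t _) M =
  M ≡ tmach j (half t) ⊎ M ≡ cmach (proj₁ (Inverse.to κ (j , t))) (proj₂ (Inverse.to κ (j , t)))

bools : List Bool
bools = true ∷ false ∷ []

rjobs : ∀ m n → List (RJob m n)
rjobs m n =
  concatMap (λ i → map (priv i) (allFin 3)) (allFin (m Data.Nat.+ m)) ++
  concatMap (λ i → map (cjob i) (allFin 3)) (allFin (m Data.Nat.+ m)) ++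
  concatMap (λ j → map (tjob j) bools) (allFin n) ++
  concatMap (λ j → concatMap (λ t → map (vjob j t) bools) (allFin 4)) (allFin n)

reduction : ∀ m {n} → Occ n ↔ Pos m → RAInstance
reduction m {n} κ = record
  { Job = RJob m n
  ; Mach = RMach m n
  ; jobs = rjobs m n
  ; size = rsize
  ; Eligible = REligible m κ
  ; _≟M_ = _≟R_
  }

module Submission where

-- A schedule of makespan 322 must fill every machine exactly: the total job size is 322 times
-- the number of machines, because the 4n variable occurrences fill the 6m clause positions
-- (2n = 3m). A full clause machine then holds exactly one clause job and one variable job of its
-- occurrence, as 100 + 111 or 101 + 110, and a full truth machine holds one truth-assignment job
-- together with the leftover variable jobs of its two occurrences, 100 + 111 + 111 or
-- 102 + 110 + 110. So the ⊤ variable jobs sitting on clause machines describe a consistent truth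
-- assignment, and since the clause jobs of C_i fill its three machines, the 100/101 split among
-- them forces exactly one (resp. two) true literals. Conversely, a satisfying assignment sends
-- each variable job to the clause machine iff its sign is the literal's value, and distributes
-- the clause jobs so that ⊤ jobs meet true literals.

open import Defs
open import Algebra.Properties.CommutativeMonoid.Sum as CommutativeMonoidSum using ()
open import Algebra.Properties.CommutativeSemigroup using (interchange)
open import Data.Bool using (Bool; true; false; if_then_else_; not; _∧_; _xor_)
open import Data.Bool.Properties using (∧-identityʳ; ∧-zeroʳ) renaming (_≟_ to _≟ᵇ_)
open import Data.Fin using (Fin; zero; suc; toℕ; punchIn)
open import Data.Fin.Patterns using (0F; 1F; 2F; 3F)
open import Data.Fin.Permutation using (↔⇒≡)
open import Data.Fin.Properties using (_≟_; all?; punchInᵢ≢i; *↔×)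
open import Data.List using (List; []; _∷_; _++_; map; concatMap; tabulate; allFin; lookup)
open import Data.List.Properties using (map-++; map-cong)
open import Data.Nat using (ℕ; zero; suc; _+_; _*_; _≤_; _⊓_; _<ᵇ_; z≤n)
open import Data.Nat.DivMod using (_mod_)
open import Data.Nat.ListAction using (sum)
open import Data.Nat.ListAction.Properties using (sum-++)
open import Data.Nat.Properties
  using ( +-0-commutativeMonoid; +-commutativeSemigroup; module ≤-Reasoning; _≤?_
        ; +-identityʳ; +-mono-≤; +-monoʳ-≤; +-cancelʳ-≤; +-cancelˡ-≡; ≤-antisym; ≤-trans; ≤-reflexive
        ; *-cancelʳ-≡; *-assoc; m≥n⇒m⊓n≡n; m≤m+n )
  renaming (_≟_ to _≟ℕ_)
open import Data.Nat.Tactic.RingSolver using (solve-∀)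
open import Data.Product using (_×_; _,_; proj₁; proj₂; ∃)
open import Data.Sum using (_⊎_; inj₁; inj₂; swap)
open import Function using (_∘_; id)
open import Function.Bundles using (_⇔_; mk⇔; _↔_; Inverse)
open import Function.Construct.Composition using (_↔-∘_)
open import Function.Construct.Symmetry using (↔-sym)
open import Relation.Binary.PropositionalEquality
open import Relation.Nullary using (Dec; ¬_)
open import Relation.Nullary.Decidable
  using (True; toWitness; _×-dec_; _→-dec_; map′; ⌊_⌋; isYes≗does; dec-true; dec-false; does-⇔)

open CommutativeMonoidSum +-0-commutativeMonoid
  using (sum-syntax; sum-cong-≗; sum-remove; sum-replicate-zero; ∑-comm; ∑-distrib-+)

private
  variable
    A B : Set
    k l : ℕ

-- `decide` proves a closed statement about booleans, small Fin types and numerals by running,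
-- during type checking, the decision procedure that instance search assembles for it.

instance
  ℕ-≡? : {x y : ℕ} → Dec (x ≡ y)
  ℕ-≡? = _ ≟ℕ _

  ℕ-≤? : {x y : ℕ} → Dec (x ≤ y)
  ℕ-≤? = _ ≤? _

  Bool-≡? : {x y : Bool} → Dec (x ≡ y)
  Bool-≡? = _ ≟ᵇ _

  ×? : {P Q : Set} → ⦃ Dec P ⦄ → ⦃ Dec Q ⦄ → Dec (P × Q)
  ×? ⦃ P? ⦄ ⦃ Q? ⦄ = P? ×-dec Q?

  →? : {P Q : Set} → ⦃ Dec P ⦄ → ⦃ Dec Q ⦄ → Dec (P → Q)
  →? ⦃ P? ⦄ ⦃ Q? ⦄ = P? →-dec Q?

  ∀-Bool? : {P : Bool → Set} → ⦃ ∀ {b} → Dec (P b) ⦄ → Dec ((b : Bool) → P b)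
  ∀-Bool? ⦃ P? ⦄ =
    map′ (λ (f , t) → λ { false → f ; true → t }) (λ h → h false , h true) (P? ×-dec P?)

  ∀-Fin? : {P : Fin k → Set} → ⦃ ∀ {i} → Dec (P i) ⦄ → Dec ((i : Fin k) → P i)
  ∀-Fin? ⦃ P? ⦄ = all? λ _ → P?

decide : {P : Set} ⦃ P? : Dec P ⦄ → {True P?} → P
decide ⦃ _ ⦄ {p} = toWitness p

⌊⌋-true : {P : Set} (P? : Dec P) → P → ⌊ P? ⌋ ≡ true
⌊⌋-true P? p = trans (isYes≗does P?) (dec-true P? p)

⌊⌋-false : {P : Set} (P? : Dec P) → ¬ P → ⌊ P? ⌋ ≡ false
⌊⌋-false P? ¬p = trans (isYes≗does P?) (dec-false P? ¬p)

⌊⌋-⇔ : {P Q : Set} → P ⇔ Q → (P? : Dec P) (Q? : Dec Q) → ⌊ P? ⌋ ≡ ⌊ Q? ⌋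
⌊⌋-⇔ P⇔Q P? Q? = trans (isYes≗does P?) (trans (does-⇔ P⇔Q P? Q?) (sym (isYes≗does Q?)))

if-either : (x : Bool) (u v : A) → (if x then u else v) ≡ u ⊎ (if x then u else v) ≡ v
if-either true  u v = inj₁ refl
if-either false u v = inj₂ refl

lookup-3 : (f : Fin 3 → A) (s : Fin 3) → f s ≡ lookup (f 0F ∷ f 1F ∷ f 2F ∷ []) s
lookup-3 f 0F = refl
lookup-3 f 1F = refl
lookup-3 f 2F = refl

-- Finite sums

∑-zero : {f : Fin k → ℕ} → (∀ i → f i ≡ 0) → ∑[ i < k ] f i ≡ 0
∑-zero {k} f≡0 = trans (sum-cong-≗ f≡0) (sum-replicate-zero k)

∑-pick : (f : Fin k → ℕ) (a : Fin k) → (∀ i → i ≢ a → f i ≡ 0) → ∑[ i < k ] f i ≡ f a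
∑-pick {suc k} f a others = begin
  ∑[ i < suc k ] f i                ≡⟨ sum-remove f ⟩
  f a + ∑[ i < k ] f (punchIn a i)   ≡⟨ cong (f a +_) (∑-zero λ i → others _ (punchInᵢ≢i a i)) ⟩
  f a + 0                            ≡⟨ +-identityʳ (f a) ⟩
  f a                                ∎
  where open ≡-Reasoning

∑∑-pick : (f : Fin k → Fin l → ℕ) (a : Fin k) (b : Fin l) →
  (∀ i j → (i , j) ≢ (a , b) → f i j ≡ 0) → ∑[ i < k ] ∑[ j < l ] f i j ≡ f a b
∑∑-pick f a b others =
  trans (∑-pick _ a λ i i≢a → ∑-zero λ j → others i j (i≢a ∘ cong proj₁))
        (∑-pick (f a) b λ j j≢b → others a j (j≢b ∘ cong proj₂))

∑-const : ∀ k c → ∑[ i < k ] c ≡ k * c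
∑-const zero    c = refl
∑-const (suc k) c = cong (c +_) (∑-const k c)

∑∑-distrib-+ : (f g : Fin k → Fin l → ℕ) →
  ∑[ i < k ] ∑[ j < l ] (f i j + g i j) ≡ ∑[ i < k ] ∑[ j < l ] f i j + ∑[ i < k ] ∑[ j < l ] g i j
∑∑-distrib-+ {l = l} f g =
  trans (sum-cong-≗ λ i → ∑-distrib-+ (f i) (g i))
        (∑-distrib-+ (λ i → ∑[ j < l ] f i j) (λ i → ∑[ j < l ] g i j))

∑-count-< : ∀ k l → ∑[ i < k ] boolToℕ (toℕ i <ᵇ l) ≡ k ⊓ l
∑-count-< zero    l       = refl
∑-count-< (suc k) zero    = ∑-zero {suc k} λ _ → refl
∑-count-< (suc k) (suc l) = cong suc (∑-count-< k l)

∑-mono-≤ : {f g : Fin k → ℕ} → (∀ i → f i ≤ g i) → ∑[ i < k ] f i ≤ ∑[ i < k ] g i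
∑-mono-≤ {zero}  f≤g = z≤n
∑-mono-≤ {suc k} f≤g = +-mono-≤ (f≤g zero) (∑-mono-≤ (f≤g ∘ suc))

+-tight : ∀ {a b c d} → a ≤ b → c ≤ d → a + c ≡ b + d → a ≡ b × c ≡ d
+-tight {a} {b} {c} {d} a≤b c≤d eq = a≡b , +-cancelˡ-≡ a c d (trans eq (cong (_+ d) (sym a≡b)))
  where
  a≡b : a ≡ b
  a≡b = ≤-antisym a≤b (+-cancelʳ-≤ d b a (≤-trans (≤-reflexive (sym eq)) (+-monoʳ-≤ a c≤d)))

∑-tight : {f g : Fin k → ℕ} → (∀ i → f i ≤ g i) →
  ∑[ i < k ] f i ≡ ∑[ i < k ] g i → ∀ i → f i ≡ g i
∑-tight {suc k} f≤g eq zero    = proj₁ (+-tight (f≤g zero) (∑-mono-≤ (f≤g ∘ suc)) eq)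
∑-tight {suc k} f≤g eq (suc i) =
  ∑-tight (f≤g ∘ suc) (proj₂ (+-tight (f≤g zero) (∑-mono-≤ (f≤g ∘ suc)) eq)) i

∑∑-tight : {f g : Fin k → Fin l → ℕ} → (∀ i j → f i j ≤ g i j) →
  ∑[ i < k ] ∑[ j < l ] f i j ≡ ∑[ i < k ] ∑[ j < l ] g i j → ∀ i j → f i j ≡ g i j
∑∑-tight f≤g eq i = ∑-tight (f≤g i) (∑-tight (λ i → ∑-mono-≤ (f≤g i)) eq i)

sum-map-++ : (g : A → ℕ) (xs ys : List A) → sum (map g (xs ++ ys)) ≡ sum (map g xs) + sum (map g ys)
sum-map-++ g xs ys = trans (cong sum (map-++ g xs ys)) (sum-++ (map g xs) (map g ys))

sum-map-concatMap-tabulate : (g : B → ℕ) (h : A → List B) (u : Fin k → A) →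
  sum (map g (concatMap h (tabulate u))) ≡ ∑[ i < k ] sum (map g (h (u i)))
sum-map-concatMap-tabulate {k = zero}  g h u = refl
sum-map-concatMap-tabulate {k = suc k} g h u =
  trans (sum-map-++ g (h (u zero)) _)
        (cong (sum (map g (h (u zero))) +_) (sum-map-concatMap-tabulate g h (u ∘ suc)))

module _ {m n : ℕ} where

  cmachAt : Pos m → RMach m n
  cmachAt (i , s) = cmach i s

  cmach-injective : ∀ {i i' s s'} → cmach {m} {n} i s ≡ cmach i' s' → (i , s) ≡ (i' , s')
  cmach-injective refl = refl

  tmach-injective : ∀ {j j' k k'} → tmach {m} {n} j k ≡ tmach j' k' → (j , k) ≡ (j' , k')
  tmach-injective refl = refl

  ≟R-refl : (M : RMach m n) → ⌊ M ≟R M ⌋ ≡ true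
  ≟R-refl M = ⌊⌋-true (M ≟R M) refl

  cmach-≟ : ∀ i (x y : Fin 3) → ⌊ cmach {m} {n} i x ≟R cmach i y ⌋ ≡ ⌊ x ≟ y ⌋
  cmach-≟ i x y = ⌊⌋-⇔ (mk⇔ (cong proj₂ ∘ cmach-injective) (cong (cmach i))) _ _

  tmach-≟ : ∀ j (x y : Fin 2) → ⌊ tmach {m} {n} j x ≟R tmach j y ⌋ ≡ ⌊ x ≟ y ⌋
  tmach-≟ j x y = ⌊⌋-⇔ (mk⇔ (cong proj₂ ∘ tmach-injective) (cong (tmach j))) _ _

  indicator-≡ : ∀ {X Y : RMach m n} c → X ≡ Y → (if ⌊ X ≟R Y ⌋ then c else 0) ≡ c
  indicator-≡ c X≡Y = cong (λ b → if b then c else 0) (⌊⌋-true (_ ≟R _) X≡Y)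

  indicator-≢ : ∀ {X Y : RMach m n} c → X ≢ Y → (if ⌊ X ≟R Y ⌋ then c else 0) ≡ 0
  indicator-≢ c X≢Y = cong (λ b → if b then c else 0) (⌊⌋-false (_ ≟R _) X≢Y)

  sum-rjobs : (g : RJob m n → ℕ) → sum (map g (rjobs m n)) ≡
      ∑[ i < m + m ] ∑[ s < 3 ] g (priv i s)
    + (∑[ i < m + m ] ∑[ s < 3 ] g (cjob i s)
    + (∑[ j < n ] sum (map (g ∘ tjob j) bools)
    +  ∑[ j < n ] ∑[ t < 4 ] sum (map (g ∘ vjob j t) bools)))
  sum-rjobs g =
    trans (sum-map-++ g privs _) (cong₂ _+_ (sum-map-concatMap-tabulate g (λ i → map (priv i) (allFin 3)) id)
    (trans (sum-map-++ g cjobs _) (cong₂ _+_ (sum-map-concatMap-tabulate g (λ i → map (cjob i) (allFin 3)) id)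
    (trans (sum-map-++ g tjobs vjobs) (cong₂ _+_ (sum-map-concatMap-tabulate g (λ j → map (tjob j) bools) id)
    (trans (sum-map-concatMap-tabulate g (λ j → concatMap (λ t → map (vjob j t) bools) (allFin 4)) id)
           (sum-cong-≗ λ j → sum-map-concatMap-tabulate g (λ t → map (vjob j t) bools) id)))))))
    where
    privs = concatMap (λ i → map (priv i) (allFin 3)) (allFin (m + m))
    cjobs = concatMap (λ i → map (cjob i) (allFin 3)) (allFin (m + m))
    tjobs = concatMap (λ j → map (tjob j) bools) (allFin n)
    vjobs = concatMap (λ j → concatMap (λ t → map (vjob j t) bools) (allFin 4)) (allFin n)

  ∑ᴹ : (RMach m n → ℕ) → ℕ
  ∑ᴹ h = ∑[ i < m + m ] ∑[ s < 3 ] h (cmach i s) + ∑[ j < n ] ∑[ k < 2 ] h (tmach j k)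

  ∑ᴹ-+ : (f g : RMach m n → ℕ) → ∑ᴹ (λ M → f M + g M) ≡ ∑ᴹ f + ∑ᴹ g
  ∑ᴹ-+ f g = trans
    (cong₂ _+_ (∑∑-distrib-+ (λ i s → f (cmach i s)) (λ i s → g (cmach i s)))
               (∑∑-distrib-+ (λ j k → f (tmach j k)) (λ j k → g (tmach j k))))
    (interchange +-commutativeSemigroup (∑ᶜ f) (∑ᶜ g) (∑ᵗ f) (∑ᵗ g))
    where
    ∑ᶜ ∑ᵗ : (RMach m n → ℕ) → ℕ
    ∑ᶜ h = ∑[ i < m + m ] ∑[ s < 3 ] h (cmach i s)
    ∑ᵗ h = ∑[ j < n ] ∑[ k < 2 ] h (tmach j k)

  ∑ᴹ-sum : (f : RMach m n → A → ℕ) (xs : List A) →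
    ∑ᴹ (λ M → sum (map (f M) xs)) ≡ sum (map (λ x → ∑ᴹ (λ M → f M x)) xs)
  ∑ᴹ-sum f []       = cong₂ _+_ (∑-zero {m + m} λ _ → refl) (∑-zero {n} λ _ → refl)
  ∑ᴹ-sum f (x ∷ xs) =
    trans (∑ᴹ-+ (λ M → f M x) (λ M → sum (map (f M) xs)))
          (cong (∑ᴹ (λ M → f M x) +_) (∑ᴹ-sum f xs))

  ∑ᴹ-indicator : ∀ X c → ∑ᴹ (λ M → if ⌊ X ≟R M ⌋ then c else 0) ≡ c
  ∑ᴹ-indicator (cmach i s) c = trans
    (cong₂ _+_ (trans (∑∑-pick _ i s λ i' s' ne → indicator-≢ c (ne ∘ sym ∘ cmach-injective))
                      (indicator-≡ c refl))
               (∑-zero {n} λ _ → refl))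
    (+-identityʳ c)
  ∑ᴹ-indicator (tmach j k) c =
    cong₂ _+_ (∑-zero {m + m} λ _ → refl)
              (trans (∑∑-pick _ j k λ j' k' ne → indicator-≢ c (ne ∘ sym ∘ tmach-injective))
                     (indicator-≡ c refl))

  ∑ᴹ-const : ∀ c → ∑ᴹ (λ _ → c) ≡ (m + m) * (3 * c) + n * (2 * c)
  ∑ᴹ-const c = cong₂ _+_ (trans (sum-cong-≗ {m + m} λ _ → ∑-const 3 c) (∑-const (m + m) (3 * c)))
                         (trans (sum-cong-≗ {n} λ _ → ∑-const 2 c) (∑-const n (2 * c)))

  ∑ᴹ-tight : (h : RMach m n → ℕ) (c : ℕ) → (∀ M → h M ≤ c) →
    ∑ᴹ h ≡ ∑ᴹ (λ _ → c) → ∀ M → h M ≡ c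
  ∑ᴹ-tight h c h≤c eq = λ where
      (cmach i s) → ∑∑-tight (λ i s → h≤c (cmach i s)) (proj₁ halves) i s
      (tmach j k) → ∑∑-tight (λ j k → h≤c (tmach j k)) (proj₂ halves) j k
    where
    halves = +-tight (∑-mono-≤ λ i → ∑-mono-≤ λ s → h≤c (cmach i s))
                     (∑-mono-≤ λ j → ∑-mono-≤ λ k → h≤c (tmach j k)) eq

  clauseJobSizes : ∀ one → 100 + ((if not one then 100 else 101) + (101 + 0)) ≡ 301 + boolToℕ one
  clauseJobSizes = decide

  totalSize : sum (map rsize (rjobs m n)) ≡ (m + m) * 333 + ((m + m) * 301 + m + (n * 202 + n * 884))
  totalSize = trans (sum-rjobs rsize)
    (cong₂ _+_ (∑-const (m + m) 333) (cong₂ _+_ clauseJobs (cong₂ _+_ (∑-const n 202) (∑-const n 884))))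
    where
    open ≡-Reasoning
    clauseJobs : ∑[ i < m + m ] ∑[ s < 3 ] rsize (cjob {m} {n} i s) ≡ (m + m) * 301 + m
    clauseJobs = begin
      ∑[ i < m + m ] ∑[ s < 3 ] rsize (cjob {m} {n} i s)
        ≡⟨ sum-cong-≗ {m + m} (λ i → clauseJobSizes (toℕ i <ᵇ m)) ⟩
      ∑[ i < m + m ] (301 + boolToℕ (toℕ i <ᵇ m))
        ≡⟨ ∑-distrib-+ {m + m} (λ _ → 301) (λ i → boolToℕ (toℕ i <ᵇ m)) ⟩
      ∑[ i < m + m ] 301 + ∑[ i < m + m ] boolToℕ (toℕ i <ᵇ m)
        ≡⟨ cong₂ _+_ (∑-const (m + m) 301) (∑-count-< (m + m) m) ⟩
      (m + m) * 301 + (m + m) ⊓ m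
        ≡⟨ cong ((m + m) * 301 +_) (m≥n⇒m⊓n≡n (m≤m+n m m)) ⟩
      (m + m) * 301 + m
        ∎

  totalSize≡capacity : n * 4 ≡ (m + m) * 3 → sum (map rsize (rjobs m n)) ≡ ∑ᴹ (λ _ → 322)
  totalSize≡capacity occurrences = begin
    sum (map rsize (rjobs m n))                                ≡⟨ totalSize ⟩
    (m + m) * 333 + ((m + m) * 301 + m + (n * 202 + n * 884))  ≡⟨ total-normal m n ⟩
    1269 * m + 644 * n + 221 * (n * 2)                         ≡⟨ cong (1269 * m + 644 * n +_) 221·2n≡221·3m ⟩
    1269 * m + 644 * n + 221 * (m * 3)                         ≡⟨ capacity-normal m n ⟨
    (m + m) * (3 * 322) + n * (2 * 322)                        ≡⟨ ∑ᴹ-const 322 ⟨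
    ∑ᴹ (λ _ → 322)                                             ∎
    where
    open ≡-Reasoning
    double : ∀ m → (m + m) * 3 ≡ m * 3 * 2
    double = solve-∀
    221·2n≡221·3m : 221 * (n * 2) ≡ 221 * (m * 3)
    221·2n≡221·3m = cong (221 *_)
      (*-cancelʳ-≡ (n * 2) (m * 3) 2 (trans (*-assoc n 2 2) (trans occurrences (double m))))
    total-normal : ∀ m n →
      (m + m) * 333 + ((m + m) * 301 + m + (n * 202 + n * 884)) ≡ 1269 * m + 644 * n + 221 * (n * 2)
    total-normal = solve-∀
    capacity-normal : ∀ m n → (m + m) * (3 * 322) + n * (2 * 322) ≡ 1269 * m + 644 * n + 221 * (m * 3)
    capacity-normal = solve-∀

-- Single-machine arithmetic

clauseMachine-exact : ∀ one z₀ z₁ z₂ x y →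
  let jobs = (if z₀ then 100 else 0) + ((if z₁ then (if not one then 100 else 101) else 0) +
             ((if z₂ then 101 else 0) + 0)) in
  111 + (jobs + ((if x then 111 else 0) + ((if y then 110 else 0) + 0))) ≡ 322 →
  y ≡ not x × jobs ≡ (if x then 100 else 101)
clauseMachine-exact = decide

leftoverLoad : Fin 2 → Fin 4 → Bool → ℕ
leftoverLoad k t X = if ⌊ half t ≟ k ⌋ then (if X then 110 else 111) else 0

leftoverPair : ∀ d X →
  (if d ∧ not X then 111 else 0) + ((if d ∧ not (not X) then 110 else 0) + 0) ≡
    (if d then (if X then 110 else 111) else 0)
leftoverPair = decide

truthMachine-exact : ∀ p q X X' →
  (if p then 100 else 0) + ((if q then 102 else 0) + 0) +
    ((if X then 110 else 111) + ((if X' then 110 else 111) + 0)) ≡ 322 →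
  X ≡ q × X' ≡ q
truthMachine-exact = decide

clauseCount-exact : ∀ one L₀ L₁ L₂ →
  (if L₀ then 100 else 101) + ((if L₁ then 100 else 101) + ((if L₂ then 100 else 101) + 0)) ≡
    100 + ((if not one then 100 else 101) + (101 + 0)) →
  boolToℕ L₀ + (boolToℕ L₁ + (boolToℕ L₂ + 0)) ≡ (if one then 1 else 2)
clauseCount-exact = decide

-- Read cyclically, the signs ⊤, ∘₂, ⊥ of the clause jobs are the literal values of a satisfied
-- clause rotated to start where its cyclic run of true literals starts.
runStart : Bool → Bool → Bool → Fin 3
runStart true  false false = 0F
runStart false true  false = 1F
runStart false false true  = 2F
runStart true  true  false = 0F
runStart false true  true  = 1F
runStart true  false true  = 2F
runStart _     _     _     = 0F

clauseSlot : (Fin 3 → Bool) → Fin 3 → Fin 3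
clauseSlot L s' = (toℕ s' + toℕ (runStart (L 0F) (L 1F) (L 2F))) mod 3

-- tmach j 0F receives the leftover variable jobs of the positive occurrences of x_j, which are
-- the ⊥ jobs exactly when x_j is true; the truth-assignment job of their sign joins them.
truthSlot : Bool → Bool → Fin 2
truthSlot x b = if b xor x then 0F else 1F

clauseMachine-fits : ∀ one L₀ L₁ L₂ (s : Fin 3) →
  boolToℕ L₀ + (boolToℕ L₁ + (boolToℕ L₂ + 0)) ≡ (if one then 1 else 2) →
  let L = lookup (L₀ ∷ L₁ ∷ L₂ ∷ [])
      z s' = ⌊ clauseSlot L s' ≟ s ⌋ in
  111 + (((if z 0F then 100 else 0) + ((if z 1F then (if not one then 100 else 101) else 0) +
          ((if z 2F then 101 else 0) + 0)))
        + ((if L s then 111 else 0) + ((if not (L s) then 110 else 0) + 0))) ≤ 322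
clauseMachine-fits = decide

truthMachine-fits : ∀ x (k : Fin 2) →
  (if ⌊ truthSlot x true ≟ k ⌋ then 100 else 0) + ((if ⌊ truthSlot x false ≟ k ⌋ then 102 else 0) + 0) +
    ∑[ t < 4 ] leftoverLoad k t (if isPositive t then x else not x) ≤ 322
truthMachine-fits = decide

module _ {m n : ℕ} (κ : Occ n ↔ Pos m) where
  open Inverse κ using (to; from; strictlyInverseˡ; strictlyInverseʳ)

  to-injective : ∀ {o o'} → to o ≡ to o' → o ≡ o'
  to-injective {o} {o'} eq = trans (sym (strictlyInverseʳ o)) (trans (cong from eq) (strictlyInverseʳ o'))

  n*4≡[m+m]*3 : n * 4 ≡ (m + m) * 3
  n*4≡[m+m]*3 = ↔⇒≡ (↔-sym (*↔× {m + m} {3}) ↔-∘ (κ ↔-∘ *↔× {n} {4}))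

  Schedule : Set
  Schedule = RJob m n → RMach m n

  Eligible : Schedule → Set
  Eligible σ = ∀ J → REligible m κ J (σ J)

  rload : Schedule → RMach m n → ℕ
  rload = load (reduction m κ)

  placed : Schedule → RJob m n → RMach m n → Bool
  placed σ J M = ⌊ σ J ≟R M ⌋

  contrib : Schedule → RMach m n → RJob m n → ℕ
  contrib σ M J = if placed σ J M then rsize J else 0

  clauseJobLoad : Schedule → Pos m → ℕ
  clauseJobLoad σ (i , s) = ∑[ s' < 3 ] contrib σ (cmach i s) (cjob i s')

  truthJobLoad : Schedule → Fin n → Fin 2 → ℕ
  truthJobLoad σ j k = sum (map (contrib σ (tmach j k) ∘ tjob j) bools)

  variablePairLoad : Schedule → RMach m n → Occ n → ℕ
  variablePairLoad σ M (j , t) = sum (map (contrib σ M ∘ vjob j t) bools)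

  onClause : Schedule → Bool → Occ n → Bool
  onClause σ b (j , t) = placed σ (vjob j t b) (cmachAt (to (j , t)))

  Complementary : Schedule → Occ n → Set
  Complementary σ o = onClause σ false o ≡ not (onClause σ true o)

  ∑ᴹ-rload : ∀ σ → ∑ᴹ (rload σ) ≡ sum (map rsize (rjobs m n))
  ∑ᴹ-rload σ = trans (∑ᴹ-sum (contrib σ) (rjobs m n))
                     (cong sum (map-cong (λ J → ∑ᴹ-indicator (σ J) (rsize J)) (rjobs m n)))

  bounded⇒full : ∀ {σ} → (∀ M → rload σ M ≤ 322) → ∀ M → rload σ M ≡ 322
  bounded⇒full {σ} bounded =
    ∑ᴹ-tight (rload σ) 322 bounded (trans (∑ᴹ-rload σ) (totalSize≡capacity {m} {n} n*4≡[m+m]*3))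

  module _ {σ : Schedule} where

    contrib-here : ∀ {J M} → σ J ≡ M → contrib σ M J ≡ rsize J
    contrib-here {J} = indicator-≡ (rsize J)

    contrib-elsewhere : ∀ {J M M'} → σ J ≡ M' → M' ≢ M → contrib σ M J ≡ 0
    contrib-elsewhere {J} refl = indicator-≢ (rsize J)

    module _ (eligible : Eligible σ) where

      rload-cmachAt : ∀ o →
        rload σ (cmachAt (to o)) ≡ 111 + (clauseJobLoad σ (to o) + variablePairLoad σ (cmachAt (to o)) o)
      rload-cmachAt o =
        trans (sum-rjobs (contrib σ M)) (cong₂ _+_ privs (cong₂ _+_ cjobs (cong₂ _+_ tjobs vjobs)))
        where
        i = proj₁ (to o)
        s = proj₂ (to o)
        M = cmach i s
        privs : ∑[ i' < m + m ] ∑[ s' < 3 ] contrib σ M (priv i' s') ≡ 111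
        privs = trans (∑∑-pick _ i s λ i' s' ne →
                         contrib-elsewhere (eligible (priv i' s')) (ne ∘ cmach-injective))
                      (contrib-here (eligible (priv i s)))
        cjobs : ∑[ i' < m + m ] ∑[ s' < 3 ] contrib σ M (cjob i' s') ≡ clauseJobLoad σ (to o)
        cjobs = ∑-pick _ i λ i' ne → ∑-zero λ s' →
          contrib-elsewhere {M = M} (proj₂ (eligible (cjob i' s'))) (ne ∘ cong proj₁ ∘ cmach-injective)
        tjobs : ∑[ j < n ] sum (map (contrib σ M ∘ tjob j) bools) ≡ 0
        tjobs = ∑-zero λ j → cong₂ _+_ (away j true) (cong (_+ 0) (away j false))
          where
          away : ∀ j b → contrib σ M (tjob j b) ≡ 0
          away j b = contrib-elsewhere {M = M} (proj₂ (eligible (tjob j b))) (λ ())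
        vjobs : ∑[ j < n ] ∑[ t < 4 ] sum (map (contrib σ M ∘ vjob j t) bools) ≡ variablePairLoad σ M o
        vjobs = ∑∑-pick _ (proj₁ o) (proj₂ o) λ j t ne →
                  cong₂ _+_ (away j t true ne) (cong (_+ 0) (away j t false ne))
          where
          away : ∀ j t b → (j , t) ≢ o → contrib σ M (vjob j t b) ≡ 0
          away j t b ne with eligible (vjob j t b)
          ... | inj₁ toTruth  = contrib-elsewhere {M = M} toTruth (λ ())
          ... | inj₂ toClause = contrib-elsewhere toClause (ne ∘ to-injective ∘ cmach-injective)

      rload-tmach : ∀ j k →
        rload σ (tmach j k) ≡ truthJobLoad σ j k + ∑[ t < 4 ] variablePairLoad σ (tmach j k) (j , t)
      rload-tmach j k =
        trans (sum-rjobs (contrib σ M)) (cong₂ _+_ privs (cong₂ _+_ cjobs (cong₂ _+_ tjobs vjobs)))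
        where
        M = tmach j k
        privs : ∑[ i < m + m ] ∑[ s < 3 ] contrib σ M (priv i s) ≡ 0
        privs = ∑-zero λ i → ∑-zero λ s → contrib-elsewhere {M = M} (eligible (priv i s)) (λ ())
        cjobs : ∑[ i < m + m ] ∑[ s < 3 ] contrib σ M (cjob i s) ≡ 0
        cjobs = ∑-zero λ i → ∑-zero λ s → contrib-elsewhere {M = M} (proj₂ (eligible (cjob i s))) (λ ())
        tjobs : ∑[ j' < n ] sum (map (contrib σ M ∘ tjob j') bools) ≡ truthJobLoad σ j k
        tjobs = ∑-pick _ j λ j' ne → cong₂ _+_ (away j' true ne) (cong (_+ 0) (away j' false ne))
          where
          away : ∀ j' b → j' ≢ j → contrib σ M (tjob j' b) ≡ 0
          away j' b ne =
            contrib-elsewhere {M = M} (proj₂ (eligible (tjob j' b))) (ne ∘ cong proj₁ ∘ tmach-injective)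
        vjobs : ∑[ j' < n ] ∑[ t < 4 ] sum (map (contrib σ M ∘ vjob j' t) bools) ≡
                ∑[ t < 4 ] variablePairLoad σ M (j , t)
        vjobs = ∑-pick _ j λ j' ne → ∑-zero λ t →
                  cong₂ _+_ (away j' t true ne) (cong (_+ 0) (away j' t false ne))
          where
          away : ∀ j' t b → j' ≢ j → contrib σ M (vjob j' t b) ≡ 0
          away j' t b ne with eligible (vjob j' t b)
          ... | inj₁ toTruth  = contrib-elsewhere {M = M} toTruth (ne ∘ cong proj₁ ∘ tmach-injective)
          ... | inj₂ toClause = contrib-elsewhere {M = M} toClause (λ ())

      placed-vjob-tmach : ∀ j t k b →
        placed σ (vjob j t b) (tmach j k) ≡ ⌊ half t ≟ k ⌋ ∧ not (onClause σ b (j , t))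
      placed-vjob-tmach j t k b = either (eligible (vjob j t b))
        where
        either : ∀ {X} → X ≡ tmach j (half t) ⊎ X ≡ cmachAt (to (j , t)) →
          ⌊ X ≟R tmach j k ⌋ ≡ ⌊ half t ≟ k ⌋ ∧ not ⌊ X ≟R cmachAt (to (j , t)) ⌋
        either (inj₁ refl) = trans (tmach-≟ j (half t) k) (sym (∧-identityʳ _))
        either (inj₂ refl) = sym (trans (cong (λ x → ⌊ half t ≟ k ⌋ ∧ not x) (≟R-refl _)) (∧-zeroʳ _))

      placed-tjob-1F : ∀ j b → placed σ (tjob j b) (tmach j 1F) ≡ not (placed σ (tjob j b) (tmach j 0F))
      placed-tjob-1F j b = either (eligible (tjob j b))
        where
        either : ∀ {X} → ∃ (λ k → X ≡ tmach j k) → ⌊ X ≟R tmach j 1F ⌋ ≡ not ⌊ X ≟R tmach j 0F ⌋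
        either (0F , refl) = trans (tmach-≟ j 0F 1F) (cong not (sym (≟R-refl _)))
        either (1F , refl) = trans (≟R-refl _) (cong not (sym (tmach-≟ j 1F 0F)))

      variablePairLoad-tmach : ∀ j t k → Complementary σ (j , t) →
        variablePairLoad σ (tmach j k) (j , t) ≡ leftoverLoad k t (onClause σ true (j , t))
      variablePairLoad-tmach j t k complementary =
        trans (cong₂ (λ x y → (if x then 111 else 0) + ((if y then 110 else 0) + 0))
                     (placed-vjob-tmach j t k true)
                     (trans (placed-vjob-tmach j t k false)
                            (cong (λ y → ⌊ half t ≟ k ⌋ ∧ not y) complementary)))
              (leftoverPair ⌊ half t ≟ k ⌋ (onClause σ true (j , t)))

      rload-tmach-complementary : (∀ o → Complementary σ o) → ∀ j k →
        rload σ (tmach j k) ≡ truthJobLoad σ j k + ∑[ t < 4 ] leftoverLoad k t (onClause σ true (j , t))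
      rload-tmach-complementary complementary j k =
        trans (rload-tmach j k) (cong (truthJobLoad σ j k +_)
              (sum-cong-≗ λ t → variablePairLoad-tmach j t k (complementary (j , t))))

      ∑-clauseJobLoad : ∀ i → ∑[ s < 3 ] clauseJobLoad σ (i , s) ≡ ∑[ s' < 3 ] rsize (cjob {m} {n} i s')
      ∑-clauseJobLoad i =
        trans (∑-comm (λ s s' → contrib σ (cmach i s) (cjob i s')))
              (sum-cong-≗ λ s' → placedOnce (eligible (cjob i s')))
        where
        placedOnce : ∀ {s'} → ∃ (λ x → σ (cjob i s') ≡ cmach i x) →
          ∑[ s < 3 ] contrib σ (cmach i s) (cjob i s') ≡ rsize (cjob {m} {n} i s')
        placedOnce (x , e) =
          trans (∑-pick _ x λ s ne → contrib-elsewhere e (ne ∘ sym ∘ cong proj₂ ∘ cmach-injective))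
                (contrib-here e)

  -- From a schedule to a satisfying assignment

  assignment : Schedule → Fin n → Bool
  assignment σ j = placed σ (tjob j false) (tmach j 0F)

  module _ {σ : Schedule} (eligible : Eligible σ) (full : ∀ M → rload σ M ≡ 322) where

    full-cmachAt : ∀ o → Complementary σ o × clauseJobLoad σ (to o) ≡ (if onClause σ true o then 100 else 101)
    full-cmachAt o =
      clauseMachine-exact (isOneInThree m i) (onMachine 0F) (onMachine 1F) (onMachine 2F)
                          (onClause σ true o) (onClause σ false o) (trans (sym (rload-cmachAt eligible o)) (full _))
      where
      i = proj₁ (to o)
      onMachine : Fin 3 → Bool
      onMachine s' = placed σ (cjob i s') (cmachAt (to o))

    rload-tmach-full : ∀ j k →
      rload σ (tmach j k) ≡ truthJobLoad σ j k + ∑[ t < 4 ] leftoverLoad k t (onClause σ true (j , t))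
    rload-tmach-full = rload-tmach-complementary eligible (proj₁ ∘ full-cmachAt)

    positiveOccurrences : ∀ j →
      onClause σ true (j , 0F) ≡ assignment σ j × onClause σ true (j , 1F) ≡ assignment σ j
    positiveOccurrences j =
      truthMachine-exact (placed σ (tjob j true) (tmach j 0F)) _ _ _ (trans (sym (rload-tmach-full j 0F)) (full _))

    negativeOccurrences : ∀ j → let q = placed σ (tjob j false) (tmach j 1F) in
      onClause σ true (j , 2F) ≡ q × onClause σ true (j , 3F) ≡ q
    negativeOccurrences j =
      truthMachine-exact (placed σ (tjob j true) (tmach j 1F)) _ _ _ (trans (sym (rload-tmach-full j 1F)) (full _))

    litValue-assignment : ∀ o → litValue (assignment σ) o ≡ onClause σ true o
    litValue-assignment (j , 0F) = sym (proj₁ (positiveOccurrences j))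
    litValue-assignment (j , 1F) = sym (proj₂ (positiveOccurrences j))
    litValue-assignment (j , 2F) = sym (trans (proj₁ (negativeOccurrences j)) (placed-tjob-1F eligible j false))
    litValue-assignment (j , 3F) = sym (trans (proj₂ (negativeOccurrences j)) (placed-tjob-1F eligible j false))

    assignment-satisfies : Satisfies m κ (assignment σ)
    assignment-satisfies i = clauseCount-exact (isOneInThree m i) (L 0F) (L 1F) (L 2F) (begin
      ∑[ s < 3 ] (if L s then 100 else 101)   ≡⟨ sum-cong-≗ {3} clauseJobLoad-literal ⟨
      ∑[ s < 3 ] clauseJobLoad σ (i , s)      ≡⟨ ∑-clauseJobLoad eligible i ⟩
      ∑[ s' < 3 ] rsize (cjob {m} {n} i s')   ∎)
      where
      open ≡-Reasoning
      L : Fin 3 → Bool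
      L s = litValue (assignment σ) (from (i , s))
      clauseJobLoad-literal : ∀ s → clauseJobLoad σ (i , s) ≡ (if L s then 100 else 101)
      clauseJobLoad-literal s = begin
        clauseJobLoad σ (i , s)
          ≡⟨ cong (clauseJobLoad σ) (strictlyInverseˡ (i , s)) ⟨
        clauseJobLoad σ (to (from (i , s)))
          ≡⟨ proj₂ (full-cmachAt (from (i , s))) ⟩
        (if onClause σ true (from (i , s)) then 100 else 101)
          ≡⟨ cong (λ x → if x then 100 else 101) (litValue-assignment (from (i , s))) ⟨
        (if L s then 100 else 101)
          ∎

  -- From a satisfying assignment to a schedule

  schedule : (Fin n → Bool) → Schedule
  schedule a (priv i s)       = cmach i s
  schedule a (cjob i s')      = cmach i (clauseSlot (λ s → litValue a (from (i , s))) s')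
  schedule a (tjob j b)       = tmach j (truthSlot (a j) b)
  schedule a (vjob j t true)  = if litValue a (j , t) then cmachAt (to (j , t)) else tmach j (half t)
  schedule a (vjob j t false) = if litValue a (j , t) then tmach j (half t) else cmachAt (to (j , t))

  schedule-eligible : ∀ a → Eligible (schedule a)
  schedule-eligible a (priv i s)       = refl
  schedule-eligible a (cjob i s')      = _ , refl
  schedule-eligible a (tjob j b)       = _ , refl
  schedule-eligible a (vjob j t true)  = swap (if-either (litValue a (j , t)) _ _)
  schedule-eligible a (vjob j t false) = if-either (litValue a (j , t)) _ _

  module _ (a : Fin n → Bool) where

    onClause-schedule : ∀ o →
      onClause (schedule a) true o ≡ litValue a o × onClause (schedule a) false o ≡ not (litValue a o)
    onClause-schedule (j , t) = onClauseOf (litValue a (j , t))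
      where
      C = cmachAt (to (j , t))
      T = tmach j (half t)
      onClauseOf : ∀ x → ⌊ (if x then C else T) ≟R C ⌋ ≡ x × ⌊ (if x then T else C) ≟R C ⌋ ≡ not x
      onClauseOf true  = ≟R-refl C , refl
      onClauseOf false = refl , ≟R-refl C

    schedule-complementary : ∀ o → Complementary (schedule a) o
    schedule-complementary o = trans (proj₂ (onClause-schedule o)) (cong not (sym (proj₁ (onClause-schedule o))))

    schedule-bounded-cmachAt : Satisfies m κ a → ∀ o → rload (schedule a) (cmachAt (to o)) ≤ 322
    schedule-bounded-cmachAt satisfies o = begin
      rload (schedule a) (cmachAt (to o))
        ≡⟨ rload-cmachAt (schedule-eligible a) o ⟩
      111 + (clauseJobLoad (schedule a) (to o) + variablePairLoad (schedule a) (cmachAt (to o)) o)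
        ≡⟨ cong₂ (λ x y → 111 + (x + y)) (sum-cong-≗ {3} clauseJob) variablePair ⟩
      111 + (∑[ s' < 3 ] (if ⌊ clauseSlot L s' ≟ s ⌋ then rsize (cjob {m} {n} i s') else 0)
            + ((if V s then 111 else 0) + ((if not (V s) then 110 else 0) + 0)))
        ≤⟨ clauseMachine-fits (isOneInThree m i) (L 0F) (L 1F) (L 2F) s (satisfies i) ⟩
      322 ∎
      where
      open ≤-Reasoning
      i = proj₁ (to o)
      s = proj₂ (to o)
      L : Fin 3 → Bool
      L x = litValue a (from (i , x))
      V = lookup (L 0F ∷ L 1F ∷ L 2F ∷ [])
      clauseJob : ∀ s' → contrib (schedule a) (cmach i s) (cjob i s') ≡
                         (if ⌊ clauseSlot L s' ≟ s ⌋ then rsize (cjob {m} {n} i s') else 0)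
      clauseJob s' = cong (λ b → if b then rsize (cjob {m} {n} i s') else 0) (cmach-≟ {m} {n} i (clauseSlot L s') s)
      literal : litValue a o ≡ V s
      literal = trans (cong (litValue a) (sym (strictlyInverseʳ o))) (lookup-3 L s)
      variablePair : variablePairLoad (schedule a) (cmachAt (to o)) o ≡
                     (if V s then 111 else 0) + ((if not (V s) then 110 else 0) + 0)
      variablePair = cong₂ (λ x y → (if x then 111 else 0) + ((if y then 110 else 0) + 0))
        (trans (proj₁ (onClause-schedule o)) literal) (trans (proj₂ (onClause-schedule o)) (cong not literal))

    schedule-bounded-tmach : ∀ j k → rload (schedule a) (tmach j k) ≤ 322
    schedule-bounded-tmach j k = begin
      rload (schedule a) (tmach j k)
        ≡⟨ rload-tmach-complementary (schedule-eligible a) schedule-complementary j k ⟩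
      truthJobLoad (schedule a) j k + ∑[ t < 4 ] leftoverLoad k t (onClause (schedule a) true (j , t))
        ≡⟨ cong₂ _+_ truthJobs (sum-cong-≗ {4} λ t →
             cong (leftoverLoad k t) (proj₁ (onClause-schedule (j , t)))) ⟩
      tjobLoad + ∑[ t < 4 ] leftoverLoad k t (litValue a (j , t))
        ≤⟨ truthMachine-fits (a j) k ⟩
      322 ∎
      where
      open ≤-Reasoning
      tjobLoad : ℕ
      tjobLoad = (if ⌊ truthSlot (a j) true ≟ k ⌋ then 100 else 0) +
                 ((if ⌊ truthSlot (a j) false ≟ k ⌋ then 102 else 0) + 0)
      truthJobs : truthJobLoad (schedule a) j k ≡ tjobLoad
      truthJobs = cong₂ (λ x y → (if x then 100 else 0) + ((if y then 102 else 0) + 0))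
        (tmach-≟ j (truthSlot (a j) true) k) (tmach-≟ j (truthSlot (a j) false) k)

    schedule-bounded : Satisfies m κ a → ∀ M → rload (schedule a) M ≤ 322
    schedule-bounded satisfies (cmach i s) =
      subst (λ p → rload (schedule a) (cmachAt p) ≤ 322) (strictlyInverseˡ (i , s))
            (schedule-bounded-cmachAt satisfies (from (i , s)))
    schedule-bounded satisfies (tmach j k) = schedule-bounded-tmach j k

mainTheorem4 : (m n : ℕ) (κ : Occ n ↔ Pos m) →
    Satisfiable m κ ⇔ HasScheduleWithin (reduction m κ) 322
mainTheorem4 m n κ = mk⇔
  (λ (a , satisfies) → schedule κ a , schedule-eligible κ a , schedule-bounded κ a satisfies)
  (λ (σ , eligible , bounded) → assignment κ σ , assignment-satisfies κ eligible (bounded⇒full κ bounded))
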